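{- Let $q\ge 3$ be a prime power, $1<k<n-1$, and $V=\mathbb{F}_q^n$. For every $(k-1)$-dimensional subspace $S$ of $V$, the set $[S\rangle^c_k$ of all non-degenerate $k$-dimensional subspaces of $V$ containing $S$ is a maximal clique of the graph $\Gamma(n,k)_q$.
   Context: $C_i=\{x\in V: x_i=0\}$. A $k$-dimensional subspace is non-degenerate if it is not contained in any $C_i$; $\mathcal{C}(n,k)_q$ is the set of such subspaces. $\Gamma(n,k)_q$ is the graph on $\mathcal{C}(n,k)_q$ where two vertices are adjacent iff their intersection is $(k-1)$-dimensional. -}

module Defs where

open import Level using (0ℓ; Lift)
import Level
open import Algebra.Bundles using (CommutativeRing)
open import Data.Nat using (ℕ; zero; suc; _^_)
open import Data.Nat.Primality using (Prime)
open import Data.Fin using (Fin)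
import Data.Fin
import Data.Nat
open import Data.Product using (Σ; ∃; _×_; _,_)
open import Data.Empty using (⊥)
open import Relation.Nullary using (¬_)
open import Relation.Binary.PropositionalEquality using (_≡_)

IsPrimePower : ℕ → Set
IsPrimePower q = Σ ℕ λ p → Σ ℕ λ e → Prime p × q ≡ p ^ suc e

module _ (R : CommutativeRing 0ℓ 0ℓ) where
  open CommutativeRing R

  IsField : Set
  IsField = (¬ (0# ≈ 1#)) × (∀ x → ¬ (x ≈ 0#) → ∃ λ y → (x * y) ≈ 1#)

  HasSize : ℕ → Set
  HasSize q = Σ (Fin q → Carrier) λ enum →
                ((i j : Fin q) → enum i ≈ enum j → i ≡ j) ×
                (∀ x → ∃ λ i → enum i ≈ x)

module LinAlg (R : CommutativeRing 0ℓ 0ℓ) (n : ℕ) where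
  open CommutativeRing R

  V : Set
  V = Fin n → Carrier

  sumF : ∀ {d} → (Fin d → Carrier) → Carrier
  sumF {zero}  f = 0#
  sumF {suc d} f = f Data.Fin.zero + sumF (λ i → f (Data.Fin.suc i))

  lincomb : ∀ {d} → (Fin d → Carrier) → (Fin d → V) → V
  lincomb c b j = sumF (λ i → c i * b i j)

  _≈V_ : V → V → Set
  x ≈V y = ∀ j → x j ≈ y j

  zeroV : V
  zeroV j = 0#

  LinIndep : ∀ {d} → (Fin d → V) → Set
  LinIndep {d} b = ∀ (c : Fin d → Carrier) → lincomb c b ≈V zeroV → ∀ i → c i ≈ 0#

  InSpan : ∀ {d} → (Fin d → V) → V → Set
  InSpan {d} b x = ∃ λ (c : Fin d → Carrier) → lincomb c b ≈V x

  SubsetV : Set₁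
  SubsetV = V → Set

  _⊆_ : SubsetV → SubsetV → Set
  P ⊆ Q = ∀ x → P x → Q x

  _≐_ : SubsetV → SubsetV → Set
  P ≐ Q = (P ⊆ Q) × (Q ⊆ P)

  _∩_ : SubsetV → SubsetV → SubsetV
  (P ∩ Q) x = P x × Q x

  IsSubspaceOfDim : ℕ → SubsetV → Set
  IsSubspaceOfDim d P = Σ (Fin d → V) λ b → LinIndep b × (∀ x → (P x → InSpan b x) × (InSpan b x → P x))

  C : Fin n → SubsetV
  C i x = x i ≈ 0#

  NonDegenerate : SubsetV → Set
  NonDegenerate W = ∀ i → ¬ (W ⊆ C i)

  Vertex : ℕ → SubsetV → Set
  Vertex k W = IsSubspaceOfDim k W × NonDegenerate W

  Adjacent : ℕ → SubsetV → SubsetV → Set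
  Adjacent k W W′ = IsSubspaceOfDim (k Data.Nat.∸ 1) (W ∩ W′)

  Family : Set₂
  Family = SubsetV → Set₁

  IsClique : ℕ → Family → Set₁
  IsClique k X = (∀ W → X W → Vertex k W) ×
                 (∀ W W′ → X W → X W′ → ¬ (W ≐ W′) → Adjacent k W W′)

  IsMaximalClique : ℕ → Family → Set₁
  IsMaximalClique k X = IsClique k X ×
                        (∀ W → Vertex k W → (∀ W′ → X W′ → Adjacent k W W′) → X W)

  StarC : ℕ → SubsetV → Family
  StarC k S W = Lift (Level.suc 0ℓ) (Vertex k W × (S ⊆ W))

-- Two distinct k-spaces through S meet exactly in S, so the star of S is a clique.
-- For maximality let W be adjacent to every member of the star and s ∈ S outside W.
-- Take nowhere-zero x, y, z with x ∉ S, y ∉ S + x, z ∉ S + x + y (possible when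
-- |F| ≥ 3 and k + 2 ≤ n); then S + x, S + y, S + z are members of the star. W meets
-- S + x in a (k-1)-space other than S, hence in a vector outside S + y, and that vector
-- together with W ∩ (S + y) spans W: so W ⊆ S + x + y, likewise W ⊆ S + x + z, and
-- therefore W ⊆ S + x. Comparing dimensions, W = S + x ∋ s.

module Submission where

open import Defs
open import Level using (0ℓ; lift; lower)
open import Algebra.Bundles using (CommutativeRing)
import Data.Nat as ℕ
open ℕ using (ℕ; zero; suc; _≤_; _<_; z≤n; s≤s)
open import Data.Nat.Properties using (≤-trans; <⇒≱; ≮⇒≥; 1+n≰n; ^-monoʳ-<; m+n≤o⇒n≤o; +-comm)
open import Data.Fin using (Fin; zero; suc; combine; finToFun; funToFin)
open import Data.Fin.Properties
  using (injective⇒≤; all?; any?; ¬∀⟶∃¬; finToFun-funToFin; funToFin-finToFin)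
  renaming (_≟_ to _≟ᶠ_)
open import Data.Vec.Functional using (_∷_)
open import Data.Product using (∃; _×_; _,_; proj₁; proj₂)
open import Data.Sum using (_⊎_; inj₁; inj₂)
open import Data.Empty using (⊥; ⊥-elim)
open import Function using (_∘_; id)
open import Function.Definitions using (Injective)
open import Relation.Binary.Definitions using (Decidable)
open import Relation.Binary.PropositionalEquality as ≡ using (_≡_)
open import Relation.Nullary using (¬_; Dec; yes; no; contradiction)
open import Relation.Nullary.Decidable using (map′; ¬?; _×-dec_)

∀-∷ : ∀ {a p} {A : Set a} {P : A → Set p} {d} {x : A} {xs : Fin d → A} →
      P x → (∀ i → P (xs i)) → ∀ i → P ((x ∷ xs) i)
∀-∷ px pxs zero    = px
∀-∷ px pxs (suc i) = pxs i

funToFin-cong : ∀ {m n} {f g : Fin m → Fin n} → (∀ i → f i ≡ g i) → funToFin f ≡ funToFin g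
funToFin-cong {zero}  f≗g = ≡.refl
funToFin-cong {suc m} f≗g = ≡.cong₂ combine (f≗g zero) (funToFin-cong (f≗g ∘ suc))

module Span (F : CommutativeRing 0ℓ 0ℓ) (n : ℕ) where
  open CommutativeRing F hiding (zero)
  open LinAlg F n
  open import Algebra.Properties.Semiring.Sum semiring
    using (sum; sum-cong-≋; ∑-distrib-+; *-distribˡ-sum; sum-replicate-zero)
  open import Algebra.Properties.Ring ring using (-1*x≈-x)
  open import Algebra.Properties.Group +-group using (x∙y⁻¹≈ε⇒x≈y)
  open import Relation.Binary.Reasoning.Setoid setoid

  ⟨_⟩ : ∀ {d} → (Fin d → V) → SubsetV
  ⟨ b ⟩ = InSpan b

  sumF≡sum : ∀ {d} (f : Fin d → Carrier) → sumF f ≡ sum f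
  sumF≡sum {zero}  f = ≡.refl
  sumF≡sum {suc d} f = ≡.cong (f zero +_) (sumF≡sum (f ∘ suc))

  sumF-cong : ∀ {d} {f g : Fin d → Carrier} → (∀ i → f i ≈ g i) → sumF f ≈ sumF g
  sumF-cong {f = f} {g} f≈g rewrite sumF≡sum f | sumF≡sum g = sum-cong-≋ f≈g

  sumF-+ : ∀ {d} (f g : Fin d → Carrier) → sumF (λ i → f i + g i) ≈ sumF f + sumF g
  sumF-+ f g rewrite sumF≡sum (λ i → f i + g i) | sumF≡sum f | sumF≡sum g = ∑-distrib-+ f g

  sumF-* : ∀ {d} a (f : Fin d → Carrier) → sumF (λ i → a * f i) ≈ a * sumF f
  sumF-* a f rewrite sumF≡sum (λ i → a * f i) | sumF≡sum f = sym (*-distribˡ-sum a f)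

  sumF-zero : ∀ d → sumF {d} (λ _ → 0#) ≈ 0#
  sumF-zero d rewrite sumF≡sum {d} (λ _ → 0#) = sum-replicate-zero d

  lincomb-cong : ∀ {d} {c c′ : Fin d → Carrier} (b : Fin d → V) →
                 (∀ i → c i ≈ c′ i) → lincomb c b ≈V lincomb c′ b
  lincomb-cong b c≈c′ j = sumF-cong (λ i → *-congʳ (c≈c′ i))

  lincomb-+ : ∀ {d} (c c′ : Fin d → Carrier) (b : Fin d → V) j →
              lincomb (λ i → c i + c′ i) b j ≈ lincomb c b j + lincomb c′ b j
  lincomb-+ c c′ b j =
    trans (sumF-cong (λ i → distribʳ (b i j) (c i) (c′ i)))
          (sumF-+ (λ i → c i * b i j) (λ i → c′ i * b i j))

  lincomb-* : ∀ {d} a (c : Fin d → Carrier) (b : Fin d → V) j →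
              lincomb (λ i → a * c i) b j ≈ a * lincomb c b j
  lincomb-* a c b j = trans (sumF-cong (λ i → *-assoc a (c i) (b i j))) (sumF-* a (λ i → c i * b i j))

  lincomb-zero : ∀ {d} (b : Fin d → V) → lincomb (λ _ → 0#) b ≈V zeroV
  lincomb-zero {d} b j = trans (sumF-cong (λ i → zeroˡ (b i j))) (sumF-zero d)

  lincomb-neg : ∀ {d} (c : Fin d → Carrier) (b : Fin d → V) j →
                lincomb (λ i → - c i) b j ≈ - lincomb c b j
  lincomb-neg c b j = begin
    lincomb (λ i → - c i) b j      ≈⟨ lincomb-cong b (λ i → sym (-1*x≈-x (c i))) j ⟩
    lincomb (λ i → - 1# * c i) b j ≈⟨ lincomb-* (- 1#) c b j ⟩
    - 1# * lincomb c b j           ≈⟨ -1*x≈-x _ ⟩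
    - lincomb c b j                ∎

  lincomb-0∷ : ∀ {d} (c : Fin d → Carrier) (y : V) (b : Fin d → V) →
               lincomb (0# ∷ c) (y ∷ b) ≈V lincomb c b
  lincomb-0∷ c y b j = trans (+-congʳ (zeroˡ (y j))) (+-identityˡ _)

  lincomb-injective : ∀ {d} {b : Fin d → V} → LinIndep b → ∀ μ ν →
                      lincomb μ b ≈V lincomb ν b → ∀ i → μ i ≈ ν i
  lincomb-injective {b = b} ind μ ν μb≈νb i =
    x∙y⁻¹≈ε⇒x≈y (μ i) (ν i) (ind (λ i → μ i - ν i) μb-νb≈0 i)
    where
    μb-νb≈0 : lincomb (λ i → μ i - ν i) b ≈V zeroV
    μb-νb≈0 j = begin
      lincomb (λ i → μ i - ν i) b j          ≈⟨ lincomb-+ μ (λ i → - ν i) b j ⟩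
      lincomb μ b j + lincomb (λ i → - ν i) b j ≈⟨ +-cong (μb≈νb j) (lincomb-neg ν b j) ⟩
      lincomb ν b j - lincomb ν b j          ≈⟨ -‿inverseʳ _ ⟩
      0#                                     ∎

  ⟨⟩-resp-≈V : ∀ {d} {b : Fin d → V} {x y} → ⟨ b ⟩ x → x ≈V y → ⟨ b ⟩ y
  ⟨⟩-resp-≈V (c , cb≈x) x≈y = c , λ j → trans (cb≈x j) (x≈y j)

  ⟨⟩-zero : ∀ {d} (b : Fin d → V) → ⟨ b ⟩ zeroV
  ⟨⟩-zero b = (λ _ → 0#) , lincomb-zero b

  ⟨⟩-+ : ∀ {d} {b : Fin d → V} {x y} → ⟨ b ⟩ x → ⟨ b ⟩ y → ⟨ b ⟩ (λ j → x j + y j)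
  ⟨⟩-+ {b = b} (c , cb≈x) (c′ , c′b≈y) =
    (λ i → c i + c′ i) , λ j → trans (lincomb-+ c c′ b j) (+-cong (cb≈x j) (c′b≈y j))

  ⟨⟩-* : ∀ {d} {b : Fin d → V} {x} a → ⟨ b ⟩ x → ⟨ b ⟩ (λ j → a * x j)
  ⟨⟩-* {b = b} a (c , cb≈x) = (λ i → a * c i) , λ j → trans (lincomb-* a c b j) (*-congˡ (cb≈x j))

  ⟨⟩-neg : ∀ {d} {b : Fin d → V} {x} → ⟨ b ⟩ x → ⟨ b ⟩ (λ j → - x j)
  ⟨⟩-neg {b = b} (c , cb≈x) = (λ i → - c i) , λ j → trans (lincomb-neg c b j) (-‿cong (cb≈x j))

  δ : ∀ {d} → Fin d → Fin d → Carrier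
  δ zero    zero    = 1#
  δ zero    (suc _) = 0#
  δ (suc _) zero    = 0#
  δ (suc i) (suc l) = δ i l

  δ≈1⊎δ≈0 : ∀ {d} (i l : Fin d) → δ i l ≈ 1# ⊎ δ i l ≈ 0#
  δ≈1⊎δ≈0 zero    zero    = inj₁ refl
  δ≈1⊎δ≈0 zero    (suc _) = inj₂ refl
  δ≈1⊎δ≈0 (suc _) zero    = inj₂ refl
  δ≈1⊎δ≈0 (suc i) (suc l) = δ≈1⊎δ≈0 i l

  sumF-δ : ∀ {d} (i : Fin d) (f : Fin d → Carrier) → sumF (λ l → δ l i * f l) ≈ f i
  sumF-δ {suc d} zero f =
    trans (+-cong (*-identityˡ _) (trans (sumF-cong (λ l → zeroˡ (f (suc l)))) (sumF-zero d)))
          (+-identityʳ _)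
  sumF-δ (suc i) f = trans (+-cong (zeroˡ _) (sumF-δ i (f ∘ suc))) (+-identityˡ _)

  e : Fin n → V
  e = δ

  e-independent : LinIndep e
  e-independent c ce≈0 i =
    trans (sym (trans (sumF-cong (λ l → *-comm (c l) (δ l i))) (sumF-δ i c))) (ce≈0 i)

  ∈⟨⟩ : ∀ {d} (b : Fin d → V) i → ⟨ b ⟩ (b i)
  ∈⟨⟩ b i = (λ l → δ l i) , λ j → sumF-δ i (λ l → b l j)

  ⟨⟩-lincomb : ∀ {d m} {a : Fin m → V} {c : Fin d → V} → (∀ i → ⟨ c ⟩ (a i)) → ∀ μ → ⟨ c ⟩ (lincomb μ a)
  ⟨⟩-lincomb {m = zero}  {c = c} a⊆⟨c⟩ μ = ⟨⟩-zero c
  ⟨⟩-lincomb {m = suc m}         a⊆⟨c⟩ μ =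
    ⟨⟩-+ (⟨⟩-* (μ zero) (a⊆⟨c⟩ zero)) (⟨⟩-lincomb (a⊆⟨c⟩ ∘ suc) (μ ∘ suc))

  ⟨⟩-⊆ : ∀ {d m} {a : Fin m → V} {c : Fin d → V} → (∀ i → ⟨ c ⟩ (a i)) → ⟨ a ⟩ ⊆ ⟨ c ⟩
  ⟨⟩-⊆ a⊆⟨c⟩ x (μ , μa≈x) = ⟨⟩-resp-≈V (⟨⟩-lincomb a⊆⟨c⟩ μ) μa≈x

  ⟨⟩-⊆-∷ : ∀ {d} (y : V) (b : Fin d → V) → ⟨ b ⟩ ⊆ ⟨ y ∷ b ⟩
  ⟨⟩-⊆-∷ y b = ⟨⟩-⊆ {a = b} {c = y ∷ b} (λ i → ∈⟨⟩ (y ∷ b) (suc i))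

  ⟨∷⟩∩⟨∷⟩⊆⟨⟩ : ∀ {d} {z y : V} {b : Fin d → V} → LinIndep (z ∷ y ∷ b) →
               (⟨ y ∷ b ⟩ ∩ ⟨ z ∷ b ⟩) ⊆ ⟨ b ⟩
  ⟨∷⟩∩⟨∷⟩⊆⟨⟩ {z = z} {y} {b} ind v ((c , cyb≈v) , (c′ , c′zb≈v)) = c ∘ suc , cb≈v
    where
    c₀≈0 : c zero ≈ 0#
    c₀≈0 = lincomb-injective {b = z ∷ y ∷ b} ind (0# ∷ c) (c′ zero ∷ 0# ∷ c′ ∘ suc)
             (λ j → trans (lincomb-0∷ c z (y ∷ b) j)
                    (trans (cyb≈v j) (sym (trans (+-congˡ (lincomb-0∷ (c′ ∘ suc) y b j)) (c′zb≈v j)))))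
             (suc zero)
    c≈0∷c : ∀ i → c i ≈ (0# ∷ c ∘ suc) i
    c≈0∷c zero    = c₀≈0
    c≈0∷c (suc i) = refl
    cb≈v : lincomb (c ∘ suc) b ≈V v
    cb≈v j = trans (sym (lincomb-0∷ (c ∘ suc) y b j)) (trans (sym (lincomb-cong (y ∷ b) c≈0∷c j)) (cyb≈v j))

  ⟨⟩-isSubspaceOfDim : ∀ {d} {b : Fin d → V} → LinIndep b → IsSubspaceOfDim d ⟨ b ⟩
  ⟨⟩-isSubspaceOfDim {b = b} ind = b , ind , λ x → id , id

  IsSubspaceOfDim-resp-≐ : ∀ {d P Q} → P ≐ Q → IsSubspaceOfDim d P → IsSubspaceOfDim d Q
  IsSubspaceOfDim-resp-≐ (P⊆Q , Q⊆P) (b , ind , P≐⟨b⟩) =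
    b , ind , λ x → proj₁ (P≐⟨b⟩ x) ∘ Q⊆P x , P⊆Q x ∘ proj₂ (P≐⟨b⟩ x)

  ⟨⟩⊆subspace : ∀ {d m W} {t : Fin m → V} → IsSubspaceOfDim d W → (∀ i → W (t i)) → ⟨ t ⟩ ⊆ W
  ⟨⟩⊆subspace (b , _ , W≐⟨b⟩) t⊆W x x∈⟨t⟩ =
    proj₂ (W≐⟨b⟩ x) (⟨⟩-⊆ (λ i → proj₁ (W≐⟨b⟩ _) (t⊆W i)) x x∈⟨t⟩)

module FiniteField (F : CommutativeRing 0ℓ 0ℓ) (isField : IsField F)
                   {q : ℕ} (size : HasSize F q) (1<q : 1 < q) (n : ℕ) where
  open CommutativeRing F hiding (zero)
  open LinAlg F n
  open Span F n
  open import Algebra.Properties.Group +-group using (inverseˡ-unique)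
  open import Relation.Binary.Reasoning.Setoid setoid

  private
    enum : Fin q → Carrier
    enum = proj₁ size

    enum-injective : ∀ i j → enum i ≈ enum j → i ≡ j
    enum-injective = proj₁ (proj₂ size)

    index : Carrier → Fin q
    index x = proj₁ (proj₂ (proj₂ size) x)

    enum-index : ∀ x → enum (index x) ≈ x
    enum-index x = proj₂ (proj₂ (proj₂ size) x)

  1≉0 : ¬ 1# ≈ 0#
  1≉0 1≈0 = proj₁ isField (sym 1≈0)

  _≟_ : Decidable _≈_
  x ≟ y = map′ (λ i≡j → trans (sym (enum-index x)) (trans (reflexive (≡.cong enum i≡j)) (enum-index y)))
               (λ x≈y → enum-injective _ _ (trans (enum-index x) (trans x≈y (sym (enum-index y)))))
               (index x ≟ᶠ index y)

  _≟V_ : Decidable _≈V_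
  x ≟V y = all? (λ j → x j ≟ y j)

  decode : ∀ {d} → Fin (q ℕ.^ d) → Fin d → Carrier
  decode i = enum ∘ finToFun i

  code : ∀ {d} → (Fin d → Carrier) → Fin (q ℕ.^ d)
  code c = funToFin (index ∘ c)

  decode-code : ∀ {d} (c : Fin d → Carrier) l → decode (code c) l ≈ c l
  decode-code c l = trans (reflexive (≡.cong enum (finToFun-funToFin (index ∘ c) l))) (enum-index (c l))

  decode-injective : ∀ {d} {i j : Fin (q ℕ.^ d)} → (∀ l → decode i l ≈ decode j l) → i ≡ j
  decode-injective {d} {i} {j} i≈j =
    ≡.trans (≡.sym (funToFin-finToFin {d} {q} i))
            (≡.trans (funToFin-cong {d} {q} (λ l → enum-injective _ _ (i≈j l)))
                     (funToFin-finToFin {d} {q} j))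

  ⟨_⟩? : ∀ {d} (b : Fin d → V) → ∀ x → Dec (⟨ b ⟩ x)
  ⟨ b ⟩? x = map′ (λ (i , ib≈x) → decode i , ib≈x)
                  (λ (c , cb≈x) → code c , λ j → trans (lincomb-cong b (decode-code c) j) (cb≈x j))
                  (any? (λ i → lincomb (decode i) b ≟V x))

  LinIndep-∷ : ∀ {d} {b : Fin d → V} {y : V} → LinIndep b → ¬ ⟨ b ⟩ y → LinIndep (y ∷ b)
  LinIndep-∷ {b = b} {y} ind y∉⟨b⟩ c cyb≈0 = c≈0
    where
    c₀y≈-cb : ∀ j → c zero * y j ≈ - lincomb (c ∘ suc) b j
    c₀y≈-cb j = inverseˡ-unique _ _ (cyb≈0 j)
    c₀≈0 : c zero ≈ 0#
    c₀≈0 with c zero ≟ 0#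
    ... | yes c₀≈0 = c₀≈0
    ... | no c₀≉0 with proj₂ isField (c zero) c₀≉0
    ...   | (c₀⁻¹ , c₀c₀⁻¹≈1) =
      contradiction (⟨⟩-resp-≈V (⟨⟩-* c₀⁻¹ (⟨⟩-neg (c ∘ suc , λ _ → refl))) y≈) y∉⟨b⟩
      where
      y≈ : ∀ j → c₀⁻¹ * - lincomb (c ∘ suc) b j ≈ y j
      y≈ j = begin
        c₀⁻¹ * - lincomb (c ∘ suc) b j ≈⟨ *-congˡ (sym (c₀y≈-cb j)) ⟩
        c₀⁻¹ * (c zero * y j)          ≈⟨ sym (*-assoc _ _ _) ⟩
        (c₀⁻¹ * c zero) * y j          ≈⟨ *-congʳ (trans (*-comm _ _) c₀c₀⁻¹≈1) ⟩
        1# * y j                       ≈⟨ *-identityˡ _ ⟩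
        y j                            ∎
    c≈0∷c : ∀ i → c i ≈ (0# ∷ c ∘ suc) i
    c≈0∷c zero    = c₀≈0
    c≈0∷c (suc i) = refl
    cb≈0 : lincomb (c ∘ suc) b ≈V zeroV
    cb≈0 j = trans (sym (lincomb-0∷ (c ∘ suc) y b j)) (trans (sym (lincomb-cong (y ∷ b) c≈0∷c j)) (cyb≈0 j))
    c≈0 : ∀ i → c i ≈ 0#
    c≈0 zero    = c₀≈0
    c≈0 (suc i) = ind (c ∘ suc) cb≈0 i

  -- Independence makes μ ↦ (coordinates of μ·a in c) an injection F^m → F^d, so q^m ≤ q^d.
  independent-in-span⇒≤ : ∀ {m d} {a : Fin m → V} {c : Fin d → V} →
                          LinIndep a → (∀ i → ⟨ c ⟩ (a i)) → m ≤ d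
  independent-in-span⇒≤ {m} {d} {a} {c} ind a⊆⟨c⟩ =
    ≮⇒≥ λ d<m → <⇒≱ (^-monoʳ-< q 1<q d<m) (injective⇒≤ {f = code ∘ coordinates ∘ decode} injective)
    where
    coordinates : (Fin m → Carrier) → Fin d → Carrier
    coordinates μ = proj₁ (⟨⟩-lincomb a⊆⟨c⟩ μ)
    coordinates-correct : ∀ μ → lincomb (coordinates μ) c ≈V lincomb μ a
    coordinates-correct μ = proj₂ (⟨⟩-lincomb a⊆⟨c⟩ μ)
    injective : Injective _≡_ _≡_ (code ∘ coordinates ∘ decode)
    injective {i} {j} same-code = decode-injective (lincomb-injective ind _ _ same-image)
      where
      same-coordinates : ∀ l → coordinates (decode i) l ≈ coordinates (decode j) l
      same-coordinates l = trans (sym (decode-code _ l))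
                                 (trans (reflexive (≡.cong (λ t → decode t l) same-code)) (decode-code _ l))
      same-image : lincomb (decode i) a ≈V lincomb (decode j) a
      same-image t = trans (sym (coordinates-correct (decode i) t))
                           (trans (lincomb-cong c same-coordinates t) (coordinates-correct (decode j) t))

  independent-in-span⇒⊇ : ∀ {d} {t b : Fin d → V} → LinIndep t → (∀ i → ⟨ b ⟩ (t i)) → ⟨ b ⟩ ⊆ ⟨ t ⟩
  independent-in-span⇒⊇ {t = t} {b} ind t⊆⟨b⟩ x x∈⟨b⟩ with ⟨ t ⟩? x
  ... | yes x∈⟨t⟩ = x∈⟨t⟩
  ... | no  x∉⟨t⟩ =
    contradiction (independent-in-span⇒≤ {a = x ∷ t} {c = b} (LinIndep-∷ ind x∉⟨t⟩)
                                         (∀-∷ {P = ⟨ b ⟩} x∈⟨b⟩ t⊆⟨b⟩))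
                  1+n≰n

  ∃-≉-both : 2 < q → ∀ a b → ∃ λ x → ¬ x ≈ a × ¬ x ≈ b
  ∃-≉-both 2<q a b with any? (λ i → ¬? (enum i ≟ a) ×-dec ¬? (enum i ≟ b))
  ... | yes (i , enum-i≉) = enum i , enum-i≉
  ... | no none = contradiction (injective⇒≤ {f = side ∘ covered} side-injective) (<⇒≱ 2<q)
    where
    covered : ∀ i → enum i ≈ a ⊎ enum i ≈ b
    covered i with enum i ≟ a | enum i ≟ b
    ... | yes ≈a | _      = inj₁ ≈a
    ... | no  _  | yes ≈b = inj₂ ≈b
    ... | no  ≉a | no ≉b  = ⊥-elim (none (i , ≉a , ≉b))
    side : ∀ {x} → x ≈ a ⊎ x ≈ b → Fin 2
    side (inj₁ _) = zero
    side (inj₂ _) = suc zero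
    same-side⇒≈ : ∀ {x y} (p : x ≈ a ⊎ x ≈ b) (p′ : y ≈ a ⊎ y ≈ b) → side p ≡ side p′ → x ≈ y
    same-side⇒≈ (inj₁ x≈a) (inj₁ y≈a) _ = trans x≈a (sym y≈a)
    same-side⇒≈ (inj₂ x≈b) (inj₂ y≈b) _ = trans x≈b (sym y≈b)
    same-side⇒≈ (inj₁ _)   (inj₂ _)   ()
    same-side⇒≈ (inj₂ _)   (inj₁ _)   ()
    side-injective : Injective _≡_ _≡_ (side ∘ covered)
    side-injective {i} {j} eq = enum-injective i j (same-side⇒≈ (covered i) (covered j) eq)

  NowhereZero : V → Set
  NowhereZero x = ∀ i → ¬ x i ≈ 0#

  𝟙 : V
  𝟙 _ = 1#

  shifted-e-nowhere-zero : ∀ {a} → ¬ a ≈ - 1# → ∀ j → NowhereZero (λ i → a * e j i + 1#)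
  shifted-e-nowhere-zero {a} a≉-1 j i v≈0 with δ≈1⊎δ≈0 j i
  ... | inj₁ δ≈1 =
    a≉-1 (inverseˡ-unique a 1# (trans (+-congʳ (sym (trans (*-congˡ δ≈1) (*-identityʳ a)))) v≈0))
  ... | inj₂ δ≈0 = 1≉0 (trans (sym (trans (+-congʳ (trans (*-congˡ δ≈0) (zeroʳ a))) (+-identityˡ 1#))) v≈0)

  shifted-e-∉⟨⟩ : ∀ {m a} {p : Fin m → V} → ¬ a ≈ 0# → ⟨ p ⟩ 𝟙 → ∀ {j} → ¬ ⟨ p ⟩ (e j) →
                  ¬ ⟨ p ⟩ (λ i → a * e j i + 1#)
  shifted-e-∉⟨⟩ {a = a} a≉0 𝟙∈⟨p⟩ {j} e∉⟨p⟩ v∈⟨p⟩ with proj₂ isField a a≉0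
  ... | (a⁻¹ , aa⁻¹≈1) = e∉⟨p⟩ (⟨⟩-resp-≈V (⟨⟩-* a⁻¹ (⟨⟩-+ v∈⟨p⟩ (⟨⟩-neg 𝟙∈⟨p⟩))) a⁻¹[v-𝟙]≈e)
    where
    a⁻¹[v-𝟙]≈e : ∀ i → a⁻¹ * ((a * e j i + 1#) - 1#) ≈ e j i
    a⁻¹[v-𝟙]≈e i = begin
      a⁻¹ * ((a * e j i + 1#) - 1#) ≈⟨ *-congˡ (+-assoc _ _ _) ⟩
      a⁻¹ * (a * e j i + (1# - 1#)) ≈⟨ *-congˡ (trans (+-congˡ (-‿inverseʳ 1#)) (+-identityʳ _)) ⟩
      a⁻¹ * (a * e j i)             ≈⟨ sym (*-assoc _ _ _) ⟩
      (a⁻¹ * a) * e j i             ≈⟨ *-congʳ (trans (*-comm _ _) aa⁻¹≈1) ⟩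
      1# * e j i                    ≈⟨ *-identityˡ _ ⟩
      e j i                         ∎

  -- Either 𝟙 avoids ⟨ p ⟩, or some unit vector e j does and then so does a e j + 𝟙 with a ∉ {0, -1}.
  ∃-nowhere-zero-∉⟨⟩ : 2 < q → ∀ {m} (p : Fin m → V) → m < n → ∃ λ x → NowhereZero x × ¬ ⟨ p ⟩ x
  ∃-nowhere-zero-∉⟨⟩ 2<q p m<n with ⟨ p ⟩? 𝟙 | all? (λ j → ⟨ p ⟩? (e j))
  ... | no 𝟙∉⟨p⟩ | _ = 𝟙 , (λ _ → 1≉0) , 𝟙∉⟨p⟩
  ... | yes _ | yes e⊆⟨p⟩ = contradiction (independent-in-span⇒≤ e-independent e⊆⟨p⟩) (<⇒≱ m<n)
  ... | yes 𝟙∈⟨p⟩ | no e⊈⟨p⟩ with ¬∀⟶∃¬ n _ (λ j → ⟨ p ⟩? (e j)) e⊈⟨p⟩ | ∃-≉-both 2<q 0# (- 1#)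
  ...   | (j , e∉⟨p⟩) | (a , a≉0 , a≉-1) =
    (λ i → a * e j i + 1#) , shifted-e-nowhere-zero a≉-1 j , shifted-e-∉⟨⟩ a≉0 𝟙∈⟨p⟩ {j} e∉⟨p⟩

  subspace-⊆-⟨⟩ : ∀ {d W} {t : Fin d → V} →
                  IsSubspaceOfDim d W → LinIndep t → (∀ i → W (t i)) → W ⊆ ⟨ t ⟩
  subspace-⊆-⟨⟩ (b , _ , W≐⟨b⟩) ind t⊆W x x∈W =
    independent-in-span⇒⊇ ind (λ i → proj₁ (W≐⟨b⟩ _) (t⊆W i)) x (proj₁ (W≐⟨b⟩ x) x∈W)

  subspace-⊆⇒⊇ : ∀ {d W U} → IsSubspaceOfDim d W → IsSubspaceOfDim d U → W ⊆ U → U ⊆ W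
  subspace-⊆⇒⊇ W-dim@(b , ind , W≐⟨b⟩) U-dim W⊆U x x∈U =
    ⟨⟩⊆subspace W-dim (λ i → proj₂ (W≐⟨b⟩ _) (∈⟨⟩ b i)) x
      (subspace-⊆-⟨⟩ U-dim ind (λ i → W⊆U _ (proj₂ (W≐⟨b⟩ _) (∈⟨⟩ b i))) x x∈U)

  subspace-∈? : ∀ {d W} → IsSubspaceOfDim d W → ∀ x → Dec (W x)
  subspace-∈? (b , _ , W≐⟨b⟩) x = map′ (proj₂ (W≐⟨b⟩ x)) (proj₁ (W≐⟨b⟩ x)) (⟨ b ⟩? x)

  ⊈⇒⊉ : ∀ {d S T s} → IsSubspaceOfDim d S → IsSubspaceOfDim d T →
        S s → ¬ T s → ∃ λ t → T t × ¬ S t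
  ⊈⇒⊉ S-dim (b , ind , T≐⟨b⟩) s∈S s∉T with all? (λ i → subspace-∈? S-dim (b i))
  ... | yes b⊆S = contradiction (proj₂ (T≐⟨b⟩ _) (subspace-⊆-⟨⟩ S-dim ind b⊆S _ s∈S)) s∉T
  ... | no b⊈S with ¬∀⟶∃¬ _ _ (λ i → subspace-∈? S-dim (b i)) b⊈S
  ...   | (i , bᵢ∉S) = b i , proj₂ (T≐⟨b⟩ _) (∈⟨⟩ b i) , bᵢ∉S

  module StarOf {d : ℕ} {S : SubsetV} (S-dim : IsSubspaceOfDim d S) where
    private
      sb : Fin d → V
      sb = proj₁ S-dim

      sb-independent : LinIndep sb
      sb-independent = proj₁ (proj₂ S-dim)

      S⊆⟨sb⟩ : S ⊆ ⟨ sb ⟩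
      S⊆⟨sb⟩ x = proj₁ (proj₂ (proj₂ S-dim) x)

      ⟨sb⟩⊆S : ⟨ sb ⟩ ⊆ S
      ⟨sb⟩⊆S x = proj₂ (proj₂ (proj₂ S-dim) x)

      sb∈S : ∀ i → S (sb i)
      sb∈S i = ⟨sb⟩⊆S (sb i) (∈⟨⟩ sb i)

    Star : Family
    Star = StarC (suc d) S

    ⊇S⇒≐⟨∷⟩ : ∀ {W v} → IsSubspaceOfDim (suc d) W → S ⊆ W → W v → ¬ ⟨ sb ⟩ v → W ≐ ⟨ v ∷ sb ⟩
    ⊇S⇒≐⟨∷⟩ {W} {v} W-dim S⊆W v∈W v∉⟨sb⟩ =
      subspace-⊆-⟨⟩ W-dim (LinIndep-∷ sb-independent v∉⟨sb⟩) v∷sb⊆W , ⟨⟩⊆subspace W-dim v∷sb⊆W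
      where
      v∷sb⊆W : ∀ i → W ((v ∷ sb) i)
      v∷sb⊆W = ∀-∷ {P = W} v∈W (λ i → S⊆W _ (sb∈S i))

    -- Two members sharing a vector outside S would both equal its span with S.
    ∩⊆S : ∀ {W W′} → Star W → Star W′ → ¬ (W ≐ W′) → (W ∩ W′) ⊆ S
    ∩⊆S {W} {W′} (lift ((W-dim , _) , S⊆W)) (lift ((W′-dim , _) , S⊆W′)) W≉W′ v (v∈W , v∈W′)
      with ⟨ sb ⟩? v
    ... | yes v∈⟨sb⟩ = ⟨sb⟩⊆S v v∈⟨sb⟩
    ... | no  v∉⟨sb⟩ =
      ⊥-elim (W≉W′ ((λ x → proj₂ W′≐ x ∘ proj₁ W≐ x) , (λ x → proj₂ W≐ x ∘ proj₁ W′≐ x)))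
      where
      W≐ : W ≐ ⟨ v ∷ sb ⟩
      W≐ = ⊇S⇒≐⟨∷⟩ W-dim S⊆W v∈W v∉⟨sb⟩
      W′≐ : W′ ≐ ⟨ v ∷ sb ⟩
      W′≐ = ⊇S⇒≐⟨∷⟩ W′-dim S⊆W′ v∈W′ v∉⟨sb⟩

    star-isClique : IsClique (suc d) Star
    star-isClique = (λ _ → proj₁ ∘ lower) , adjacent
      where
      adjacent : ∀ W W′ → Star W → Star W′ → ¬ (W ≐ W′) → Adjacent (suc d) W W′
      adjacent W W′ W∈Star@(lift (_ , S⊆W)) W′∈Star@(lift (_ , S⊆W′)) W≉W′ =
        IsSubspaceOfDim-resp-≐ ((λ x x∈S → S⊆W x x∈S , S⊆W′ x x∈S) , ∩⊆S W∈Star W′∈Star W≉W′) S-dim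

    ⟨∷⟩∈Star : ∀ {u} → NowhereZero u → ¬ ⟨ sb ⟩ u → Star ⟨ u ∷ sb ⟩
    ⟨∷⟩∈Star {u} u-nz u∉⟨sb⟩ =
      lift ((⟨⟩-isSubspaceOfDim {b = u ∷ sb} (LinIndep-∷ sb-independent u∉⟨sb⟩) ,
             (λ i ⊆Cᵢ → u-nz i (⊆Cᵢ u (∈⟨⟩ (u ∷ sb) zero)))) ,
            (λ x x∈S → ⟨⟩-⊆-∷ u sb x (S⊆⟨sb⟩ x x∈S)))

    module _ {W} (W-dim : IsSubspaceOfDim (suc d) W) (adjacent : ∀ W′ → Star W′ → Adjacent (suc d) W W′)
             {s} (s∈S : S s) (s∉W : ¬ W s) where

      W⊆⟨∷∷⟩ : ∀ {u₁ u₂} → NowhereZero u₁ → ¬ ⟨ sb ⟩ u₁ → NowhereZero u₂ → ¬ ⟨ u₁ ∷ sb ⟩ u₂ →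
               W ⊆ ⟨ u₂ ∷ u₁ ∷ sb ⟩
      W⊆⟨∷∷⟩ {u₁} {u₂} u₁-nz u₁∉⟨sb⟩ u₂-nz u₂∉⟨u₁∷sb⟩ =
        via (⊈⇒⊉ S-dim (adjacent ⟨ u₁ ∷ sb ⟩ W₁∈Star) s∈S (s∉W ∘ proj₁)) (adjacent ⟨ u₂ ∷ sb ⟩ W₂∈Star)
        where
        W₁∈Star : Star ⟨ u₁ ∷ sb ⟩
        W₁∈Star = ⟨∷⟩∈Star u₁-nz u₁∉⟨sb⟩
        W₂∈Star : Star ⟨ u₂ ∷ sb ⟩
        W₂∈Star = ⟨∷⟩∈Star u₂-nz (u₂∉⟨u₁∷sb⟩ ∘ ⟨⟩-⊆-∷ u₁ sb u₂)
        W₁≉W₂ : ¬ (⟨ u₁ ∷ sb ⟩ ≐ ⟨ u₂ ∷ sb ⟩)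
        W₁≉W₂ (_ , W₂⊆W₁) = u₂∉⟨u₁∷sb⟩ (W₂⊆W₁ u₂ (∈⟨⟩ (u₂ ∷ sb) zero))
        W₂⊆⟨∷∷⟩ : ⟨ u₂ ∷ sb ⟩ ⊆ ⟨ u₂ ∷ u₁ ∷ sb ⟩
        W₂⊆⟨∷∷⟩ = ⟨⟩-⊆ {a = u₂ ∷ sb} {c = u₂ ∷ u₁ ∷ sb}
                    (∀-∷ {P = ⟨ u₂ ∷ u₁ ∷ sb ⟩} (∈⟨⟩ (u₂ ∷ u₁ ∷ sb) zero)
                                                 (λ i → ∈⟨⟩ (u₂ ∷ u₁ ∷ sb) (suc (suc i))))
        via : (∃ λ w → (W ∩ ⟨ u₁ ∷ sb ⟩) w × ¬ S w) → IsSubspaceOfDim d (W ∩ ⟨ u₂ ∷ sb ⟩) →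
              W ⊆ ⟨ u₂ ∷ u₁ ∷ sb ⟩
        via (w , (w∈W , w∈W₁) , w∉S) (t , t-independent , W∩W₂≐⟨t⟩) x x∈W =
          ⟨⟩-⊆ {a = w ∷ t} {c = u₂ ∷ u₁ ∷ sb} w∷t⊆⟨∷∷⟩ x
            (subspace-⊆-⟨⟩ W-dim (LinIndep-∷ t-independent w∉⟨t⟩) w∷t⊆W x x∈W)
          where
          w∉⟨t⟩ : ¬ ⟨ t ⟩ w
          w∉⟨t⟩ w∈⟨t⟩ = w∉S (∩⊆S W₁∈Star W₂∈Star W₁≉W₂ w (w∈W₁ , proj₂ (proj₂ (W∩W₂≐⟨t⟩ w) w∈⟨t⟩)))
          w∷t⊆W : ∀ i → W ((w ∷ t) i)
          w∷t⊆W = ∀-∷ {P = W} w∈W (λ i → proj₁ (proj₂ (W∩W₂≐⟨t⟩ _) (∈⟨⟩ t i)))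
          w∷t⊆⟨∷∷⟩ : ∀ i → ⟨ u₂ ∷ u₁ ∷ sb ⟩ ((w ∷ t) i)
          w∷t⊆⟨∷∷⟩ = ∀-∷ {P = ⟨ u₂ ∷ u₁ ∷ sb ⟩} (⟨⟩-⊆-∷ u₂ (u₁ ∷ sb) w w∈W₁)
                        (λ i → W₂⊆⟨∷∷⟩ _ (proj₂ (proj₂ (W∩W₂≐⟨t⟩ _) (∈⟨⟩ t i))))

      W⊆⟨∷⟩ : ∀ {x y z} → NowhereZero x → ¬ ⟨ sb ⟩ x → NowhereZero y → ¬ ⟨ x ∷ sb ⟩ y →
              NowhereZero z → ¬ ⟨ y ∷ x ∷ sb ⟩ z → W ⊆ ⟨ x ∷ sb ⟩
      W⊆⟨∷⟩ {x} {y} {z} x-nz x∉ y-nz y∉ z-nz z∉ v v∈W =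
        ⟨∷⟩∩⟨∷⟩⊆⟨⟩ {z = z} {y} {x ∷ sb} z∷y∷x∷sb-independent v
          (W⊆⟨∷∷⟩ x-nz x∉ y-nz y∉ v v∈W , W⊆⟨∷∷⟩ x-nz x∉ z-nz (z∉ ∘ ⟨⟩-⊆-∷ y (x ∷ sb) z) v v∈W)
        where
        x∷sb-independent : LinIndep (x ∷ sb)
        x∷sb-independent = LinIndep-∷ {b = sb} sb-independent x∉
        y∷x∷sb-independent : LinIndep (y ∷ x ∷ sb)
        y∷x∷sb-independent = LinIndep-∷ {b = x ∷ sb} x∷sb-independent y∉
        z∷y∷x∷sb-independent : LinIndep (z ∷ y ∷ x ∷ sb)
        z∷y∷x∷sb-independent = LinIndep-∷ {b = y ∷ x ∷ sb} y∷x∷sb-independent z∉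

      S⊈W-impossible : 2 < q → suc (suc d) < n → ⊥
      S⊈W-impossible 2<q d+2<n with ∃-nowhere-zero-∉⟨⟩ 2<q sb (m+n≤o⇒n≤o 2 d+2<n)
      ... | (x , x-nz , x∉) with ∃-nowhere-zero-∉⟨⟩ 2<q (x ∷ sb) (m+n≤o⇒n≤o 1 d+2<n)
      ... | (y , y-nz , y∉) with ∃-nowhere-zero-∉⟨⟩ 2<q (y ∷ x ∷ sb) d+2<n
      ... | (z , z-nz , z∉) =
        s∉W (subspace-⊆⇒⊇ W-dim (⟨⟩-isSubspaceOfDim {b = x ∷ sb} (LinIndep-∷ sb-independent x∉))
                              (W⊆⟨∷⟩ x-nz x∉ y-nz y∉ z-nz z∉) s (⟨⟩-⊆-∷ x sb s (S⊆⟨sb⟩ s s∈S)))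

    star-isMaximalClique : 2 < q → suc (suc d) < n → IsMaximalClique (suc d) Star
    star-isMaximalClique 2<q d+2<n = star-isClique , maximal
      where
      maximal : ∀ W → Vertex (suc d) W → (∀ W′ → Star W′ → Adjacent (suc d) W W′) → Star W
      maximal W W-vertex@(W-dim , _) adjacent with all? (λ i → subspace-∈? W-dim (sb i))
      ... | yes sb⊆W = lift (W-vertex , λ x x∈S → ⟨⟩⊆subspace W-dim sb⊆W x (S⊆⟨sb⟩ x x∈S))
      ... | no  sb⊈W with ¬∀⟶∃¬ _ _ (λ i → subspace-∈? W-dim (sb i)) sb⊈W
      ...   | (i , sbᵢ∉W) = ⊥-elim (S⊈W-impossible W-dim adjacent (sb∈S i) sbᵢ∉W 2<q d+2<n)

open import Data.Nat using (ℕ; _≤_; _+_; _∸_)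

proposition1 : (q n k : ℕ) → IsPrimePower q → 3 ≤ q → 2 ≤ k → k + 2 ≤ n →
    (F : CommutativeRing 0ℓ 0ℓ) → IsField F → HasSize F q →
    (S : LinAlg.SubsetV F n) → LinAlg.IsSubspaceOfDim F n (k ∸ 1) S →
    LinAlg.IsMaximalClique F n k (LinAlg.StarC F n k S)
proposition1 q n .(suc d) _ 3≤q (s≤s {n = d} _) k+2≤n F isField size S S-dim =
  star-isMaximalClique 3≤q (≡.subst (λ m → suc m ≤ n) (+-comm d 2) k+2≤n)
  where
  open FiniteField F isField size (≤-trans (s≤s (s≤s z≤n)) 3≤q) n
  open StarOf S-dim
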